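{- Let $G$ be a finite connected graph (multiple edges allowed, no loops) and let $G'$ be a connected subgraph of $G$. Then $\mathrm{sn}(G')\leq \mathrm{sn}(G)$.
   Context: A subgraph of $G$ is a graph obtained from $G$ by deleting edges and deleting isolated vertices. For $A,B\subseteq V(G)$, $E_G(A,B)$ is the set of edges of $G$ with one endpoint in $A$ and the other in $B$; $A^c=V(G)\setminus A$. A set $B\subseteq V(G)$ is connected if for every proper subset $A\subsetneq B$ the set $E_G(A,B\setminus A)$ is nonempty. A scramble is a finite set $\mathscr{S}$ of connected subsets of $V(G)$ (eggs). A hitting set is a set $C\subseteq V(G)$ meeting every egg. The scramble order $\|\mathscr{S}\|$ is the maximum integer $k$ such that (1) no $C\subseteq V(G)$ with $|C|<k$ is a hitting set for $\mathscr{S}$, and (2) for every $A\subseteq V(G)$ for which there are eggs $E,E'\in\mathscr{S}$ with $E\subseteq A$ and $E'\subseteq A^c$, one has $|E_G(A,A^c)|\geq k$. The scramble number $\mathrm{sn}(G)$ is the maximum scramble order of a scramble in $G$. -}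

module Defs where

open import Data.Nat using (ℕ; _≤_; _<_; suc)
open import Data.Fin using (Fin)
open import Data.Fin.Subset using (Subset; _∈_; _∉_; _⊆_; _⊂_; ∁; ∣_∣; Nonempty; _─_; ⊤)
open import Data.Bool using (_xor_)
open import Data.Vec using (lookup; tabulate)
open import Data.List using (List)
open import Data.List.Membership.Propositional using () renaming (_∈_ to _∈ₗ_)
open import Data.Product using (Σ; ∃; _×_; _,_)
open import Data.Sum using (_⊎_)
open import Relation.Binary.PropositionalEquality using (_≡_; _≢_)
open import Function.Definitions using (Injective)

-- A finite loopless multigraph: vertices Fin nV, edges Fin nE,
-- each edge e has endpoints src e and tgt e (orientation irrelevant).
record Graph : Set where
  field
    nV   : ℕ
    nE   : ℕ
    src  : Fin nE → Fin nV
    tgt  : Fin nE → Fin nV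
    loopless : ∀ e → src e ≢ tgt e
open Graph public

module _ (G : Graph) where

  Joins : Subset (nV G) → Subset (nV G) → Fin (nE G) → Set
  Joins A B e = (src G e ∈ A × tgt G e ∈ B) ⊎ (tgt G e ∈ A × src G e ∈ B)

  EdgesBetweenNonempty : Subset (nV G) → Subset (nV G) → Set
  EdgesBetweenNonempty A B = ∃ λ e → Joins A B e

  cutSize : Subset (nV G) → ℕ
  cutSize A = ∣ tabulate (λ e → lookup A (src G e) xor lookup A (tgt G e)) ∣

  ConnectedSet : Subset (nV G) → Set
  ConnectedSet B = ∀ A → Nonempty A → A ⊂ B → EdgesBetweenNonempty A (B ─ A)

  ConnectedGraph : Set
  ConnectedGraph = (0 < nV G) × ConnectedSet ⊤

  Scramble : Set
  Scramble = Σ (List (Subset (nV G))) λ S → ∀ E → E ∈ₗ S → ConnectedSet E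

  HittingSet : List (Subset (nV G)) → Subset (nV G) → Set
  HittingSet S C = ∀ E → E ∈ₗ S → ∃ λ v → v ∈ C × v ∈ E

  OrderCondition : List (Subset (nV G)) → ℕ → Set
  OrderCondition S k =
    (∀ C → ∣ C ∣ < k → HittingSet S C → Data.Empty.⊥) ×
    (∀ A E E' → E ∈ₗ S → E' ∈ₗ S → E ⊆ A → E' ⊆ ∁ A → k ≤ cutSize A)
    where import Data.Empty

  IsScrambleOrder : Scramble → ℕ → Set
  IsScrambleOrder (S , _) k =
    OrderCondition S k × (∀ j → OrderCondition S j → j ≤ k)

  IsScrambleNumber : ℕ → Set
  IsScrambleNumber s =
    (∃ λ S → IsScrambleOrder S s) × (∀ S k → IsScrambleOrder S k → k ≤ s)

record IsSubgraph (H G : Graph) : Set where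
  field
    φ : Fin (nV H) → Fin (nV G)
    ψ : Fin (nE H) → Fin (nE G)
    φ-inj : Injective _≡_ _≡_ φ
    ψ-inj : Injective _≡_ _≡_ ψ
    ends : ∀ e → (src G (ψ e) ≡ φ (src H e) × tgt G (ψ e) ≡ φ (tgt H e))
               ⊎ (src G (ψ e) ≡ φ (tgt H e) × tgt G (ψ e) ≡ φ (src H e))

-- Push a scramble of G' forward along the embedding G' ↪ G. Eggs stay connected; a hitting
-- set C of the new scramble pulls back to a hitting set φ⁻¹(C) of the old one with at most
-- |C| vertices; and a separating set A pulls back to a separating set φ⁻¹(A) whose cut,
-- being mapped injectively into E_G(A, Aᶜ) by ψ, is no larger. So every k satisfying the
-- order conditions for the old scramble satisfies them for the new one, whence
-- sn(G') ≤ sn(G). The order of a scramble is the greatest k satisfying a predicate bounded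
-- by |V(G)|; constructively that maximum exists only under a double negation, which is
-- enough since the conclusion s' ≤ s is decidable.
module Submission where

open import Defs
open import Data.Nat using (ℕ; _≤_; _<_; suc; z≤n; s≤s; _≤?_; _+_)
open import Data.Nat.Properties
  using (≤-trans; ≤-refl; <⇒≤; ≮⇒≥; +-suc; +-identityʳ; n≮n; ≤-<-trans; m≤n+m; +-monoˡ-≤; ≤-reflexive)
open import Data.Fin using (Fin; zero; suc)
open import Data.Fin.Properties using (any?; suc-injective) renaming (_≟_ to _≟ᶠ_)
open import Data.Fin.Subset using (Subset; _∈_; _∉_; _⊆_; _⊂_; ∁; ∣_∣; Nonempty; _─_; ⊤; ⊥; _∩_; _-_)
open import Data.Fin.Subset.Properties
  using (_∈?_; x∈p∩q⁺; x∈p∩q⁻; p∩q⊆p; p─q⊆p; x∈p∧x∉q⇒x∈p─q; x∈p∧x≢y⇒x∈p-y; x∈p⇒∣p-x∣<∣p∣;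
         x∉p⇒x∈∁p; x∈∁p⇒x∉p; ∈⊤; ∣⊤∣≡n; ∣⊥∣≡0; Empty-unique; nonempty?)
open import Data.Bool using (Bool; true; false; _xor_)
open import Data.Bool.Properties using (xor-comm; T-≡)
open import Data.Vec using ([]; _∷_; here; there; lookup; tabulate)
open import Data.Vec.Properties using (lookup∘tabulate; []=⇒lookup; lookup⇒[]=; lookup-replicate)
open import Data.List using (map)
open import Data.List.Membership.Propositional using (find) renaming (_∈_ to _∈ₗ_)
open import Data.List.Membership.Propositional.Properties using (∈-map⁻; ∈-map⁺)
open import Data.List.Relation.Unary.All as All using (all?)
open import Data.List.Relation.Unary.All.Properties using (¬All⇒Any¬)
open import Data.Product using (∃; _×_; _,_; proj₂)
open import Data.Sum using (inj₁; inj₂)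
open import Data.Empty using (⊥-elim)
import Data.Empty as Empty
open import Function.Bundles using (Equivalence)
open import Function.Definitions using (Injective)
open import Relation.Nullary using (¬_; Dec; yes; no)
open import Relation.Nullary.Decidable using (_×-dec_; decidable-stable; isYes; fromWitness; toWitness; ¬¬-excluded-middle)
open import Relation.Binary.PropositionalEquality using (_≡_; refl; sym; trans; subst; subst₂; cong; _≢_)

x∈tabulate⁺ : ∀ {n} (f : Fin n → Bool) {i} → f i ≡ true → i ∈ tabulate f
x∈tabulate⁺ f {i} fi = lookup⇒[]= i _ (trans (lookup∘tabulate f i) fi)

x∈tabulate⁻ : ∀ {n} (f : Fin n → Bool) {i} → i ∈ tabulate f → f i ≡ true
x∈tabulate⁻ f {i} i∈ = trans (sym (lookup∘tabulate f i)) ([]=⇒lookup i∈)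

x∈p─q⇒x∉q : ∀ {n} (p q : Subset n) {x} → x ∈ p ─ q → x ∉ q
x∈p─q⇒x∉q (_ ∷ p) (true  ∷ q) {zero}  ()
x∈p─q⇒x∉q (_ ∷ p) (false ∷ q) {zero}  here ()
x∈p─q⇒x∉q (_ ∷ p) (_     ∷ q) {suc x} (there x∈) (there x∈q) = x∈p─q⇒x∉q p q x∈ x∈q

∣p∣≤∣q∣-by-injection : ∀ {m n} (f : Fin m → Fin n) → Injective _≡_ _≡_ f →
  (p : Subset m) (q : Subset n) → (∀ {x} → x ∈ p → f x ∈ q) → ∣ p ∣ ≤ ∣ q ∣
∣p∣≤∣q∣-by-injection f f-inj []          q f[p]⊆q = z≤n
∣p∣≤∣q∣-by-injection f f-inj (false ∷ p) q f[p]⊆q =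
  ∣p∣≤∣q∣-by-injection (λ x → f (suc x)) (λ eq → suc-injective (f-inj eq)) p q (λ x∈ → f[p]⊆q (there x∈))
∣p∣≤∣q∣-by-injection f f-inj (true ∷ p) q f[p]⊆q =
  ≤-trans (s≤s ∣p∣≤∣q-f0∣) (x∈p⇒∣p-x∣<∣p∣ (f[p]⊆q here))
  where
  fsuc≢f0 : ∀ {x} → f (suc x) ≢ f zero
  fsuc≢f0 eq with f-inj eq
  ... | ()
  ∣p∣≤∣q-f0∣ : ∣ p ∣ ≤ ∣ q - f zero ∣
  ∣p∣≤∣q-f0∣ = ∣p∣≤∣q∣-by-injection (λ x → f (suc x)) (λ eq → suc-injective (f-inj eq)) p (q - f zero)
    (λ x∈ → x∈p∧x≢y⇒x∈p-y (f[p]⊆q (there x∈)) fsuc≢f0)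

¬¬-greatest : (P : ℕ → Set) {b : ℕ} → (∀ j → P j → j ≤ b) → ∀ {m} → P m →
  ¬ ¬ (∃ λ k → P k × (∀ j → P j → j ≤ k) × m ≤ k)
¬¬-greatest P {b} bounded {m} Pm =
  search (suc b) Pm (λ j Pj → ≤-trans (s≤s (bounded j Pj)) (m≤n+m (suc b) m))
  where
  search : ∀ fuel {m} → P m → (∀ j → P j → j < m + fuel) →
    ¬ ¬ (∃ λ k → P k × (∀ j → P j → j ≤ k) × m ≤ k)
  search 0 {m} Pm below = ⊥-elim (n≮n m (subst (m <_) (+-identityʳ m) (below m Pm)))
  search (suc fuel) {m} Pm below no-greatest = ¬¬-excluded-middle {A = ∃ λ j → P j × m < j} λ
    { (yes (j , Pj , m<j)) →
        search fuel Pj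
          (λ i Pi → ≤-trans (below i Pi) (≤-trans (≤-reflexive (+-suc m fuel)) (+-monoˡ-≤ fuel m<j)))
          (λ (k , Pk , k-greatest , j≤k) → no-greatest (k , Pk , k-greatest , ≤-trans (<⇒≤ m<j) j≤k))
    ; (no nothing-above) →
        no-greatest (m , Pm , (λ j Pj → ≮⇒≥ λ m<j → nothing-above (j , Pj , m<j)) , ≤-refl)
    }

crosses : (G : Graph) → Subset (nV G) → Fin (nE G) → Bool
crosses G A e = lookup A (src G e) xor lookup A (tgt G e)

module _ (G : Graph) where

  cutSize-⊥ : cutSize G ⊥ ≡ 0
  cutSize-⊥ = trans (cong ∣_∣ (Empty-unique nothing-crosses)) (∣⊥∣≡0 (nE G))
    where
    nothing-crosses : ¬ Nonempty (tabulate (crosses G ⊥))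
    nothing-crosses (e , e∈)
      with subst₂ (λ a b → a xor b ≡ true) (lookup-replicate (src G e) false)
                  (lookup-replicate (tgt G e) false) (x∈tabulate⁻ (crosses G ⊥) e∈)
    ... | ()

  -- An empty egg lies on both sides of the empty cut; otherwise V(G) is a hitting set.
  OrderCondition⇒≤nV : ∀ S k → OrderCondition G S k → k ≤ nV G
  OrderCondition⇒≤nV S k (unhittable , cut-bound) with all? nonempty? S
  ... | yes all-nonempty = subst (k ≤_) (∣⊤∣≡n (nV G)) (≮⇒≥ λ ∣⊤∣<k → unhittable ⊤ ∣⊤∣<k ⊤-hits)
    where
    ⊤-hits : HittingSet G S ⊤
    ⊤-hits E E∈S = let (v , v∈E) = All.lookup all-nonempty E∈S in v , ∈⊤ , v∈E
  ... | no some-empty with find (¬All⇒Any¬ nonempty? S some-empty)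
  ...   | E , E∈S , E-empty =
    ≤-trans (subst (k ≤_) cutSize-⊥ (cut-bound ⊥ E E E∈S E∈S E⊆anything E⊆anything)) z≤n
    where
    E⊆anything : ∀ {A} → E ⊆ A
    E⊆anything x∈E = ⊥-elim (E-empty (_ , x∈E))

module Pushforward (G G' : Graph) (G'⊆G : IsSubgraph G' G) where
  open IsSubgraph G'⊆G

  preimage : Subset (nV G) → Subset (nV G')
  preimage A = tabulate (λ u → lookup A (φ u))

  ∈-preimage⁺ : ∀ {A u} → φ u ∈ A → u ∈ preimage A
  ∈-preimage⁺ {A} φu∈A = x∈tabulate⁺ (λ u → lookup A (φ u)) ([]=⇒lookup φu∈A)

  ∈-preimage⁻ : ∀ {A u} → u ∈ preimage A → φ u ∈ A
  ∈-preimage⁻ {A} {u} u∈ = lookup⇒[]= (φ u) A (x∈tabulate⁻ (λ u → lookup A (φ u)) u∈)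

  hasPreimage? : (X : Subset (nV G')) (v : Fin (nV G)) → Dec (∃ λ u → u ∈ X × φ u ≡ v)
  hasPreimage? X v = any? (λ u → (u ∈? X) ×-dec (φ u ≟ᶠ v))

  image : Subset (nV G') → Subset (nV G)
  image X = tabulate (λ v → isYes (hasPreimage? X v))

  ∈-image⁺ : ∀ {X u} → u ∈ X → φ u ∈ image X
  ∈-image⁺ {X} {u} u∈X =
    x∈tabulate⁺ (λ v → isYes (hasPreimage? X v)) (Equivalence.to T-≡ (fromWitness (u , u∈X , refl)))

  ∈-image⁻ : ∀ {X v} → v ∈ image X → ∃ λ u → u ∈ X × φ u ≡ v
  ∈-image⁻ {X} {v} v∈ =
    toWitness {a? = hasPreimage? X v} (Equivalence.from T-≡ (x∈tabulate⁻ (λ v → isYes (hasPreimage? X v)) v∈))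

  private
    along : ∀ {X : Subset (nV G)} {x y} → x ≡ y → y ∈ X → x ∈ X
    along {X} x≡y = subst (_∈ X) (sym x≡y)

  Joins-ψ : ∀ {A' B' A B} → (∀ {u} → u ∈ A' → φ u ∈ A) → (∀ {u} → u ∈ B' → φ u ∈ B) →
    ∀ e → Joins G' A' B' e → Joins G A B (ψ e)
  Joins-ψ φ[A']⊆A φ[B']⊆B e joins with ends e | joins
  ... | inj₁ (s , t) | inj₁ (a , b) = inj₁ (along s (φ[A']⊆A a) , along t (φ[B']⊆B b))
  ... | inj₁ (s , t) | inj₂ (a , b) = inj₂ (along t (φ[A']⊆A a) , along s (φ[B']⊆B b))
  ... | inj₂ (s , t) | inj₁ (a , b) = inj₂ (along t (φ[A']⊆A a) , along s (φ[B']⊆B b))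
  ... | inj₂ (s , t) | inj₂ (a , b) = inj₁ (along s (φ[A']⊆A a) , along t (φ[B']⊆B b))

  ConnectedSet-image : ∀ F → ConnectedSet G' F → ConnectedSet G (image F)
  ConnectedSet-image F F-connected A (v , v∈A) (A⊆φ[F] , w , w∈φ[F] , w∉A)
    with ∈-image⁻ (A⊆φ[F] v∈A) | ∈-image⁻ w∈φ[F]
  ... | u , u∈F , refl | u' , u'∈F , refl =
    let e , joins = F-connected A' (u , x∈p∩q⁺ (u∈F , ∈-preimage⁺ v∈A)) A'⊂F
    in ψ e , Joins-ψ φ[A']⊆A φ[F─A']⊆φ[F]─A e joins
    where
    A' : Subset (nV G')
    A' = F ∩ preimage A
    φ[A']⊆A : ∀ {x} → x ∈ A' → φ x ∈ A
    φ[A']⊆A x∈A' = ∈-preimage⁻ (proj₂ (x∈p∩q⁻ F (preimage A) x∈A'))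
    φ[F─A']⊆φ[F]─A : ∀ {x} → x ∈ F ─ A' → φ x ∈ image F ─ A
    φ[F─A']⊆φ[F]─A {x} x∈F─A' = x∈p∧x∉q⇒x∈p─q (∈-image⁺ x∈F) λ φx∈A →
      x∈p─q⇒x∉q F A' x∈F─A' (x∈p∩q⁺ (x∈F , ∈-preimage⁺ φx∈A))
      where
      x∈F : x ∈ F
      x∈F = p─q⊆p F A' x∈F─A'
    A'⊂F : A' ⊂ F
    A'⊂F = p∩q⊆p F (preimage A) , u' , u'∈F , λ u'∈A' → w∉A (φ[A']⊆A u'∈A')

  crosses-ψ : ∀ A e → crosses G A (ψ e) ≡ crosses G' (preimage A) e
  crosses-ψ A e rewrite lookup∘tabulate (λ u → lookup A (φ u)) (src G' e)
                      | lookup∘tabulate (λ u → lookup A (φ u)) (tgt G' e) with ends e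
  ... | inj₁ (s , t) rewrite s | t = refl
  ... | inj₂ (s , t) rewrite s | t = xor-comm (lookup A (φ (tgt G' e))) (lookup A (φ (src G' e)))

  cutSize-preimage-≤ : ∀ A → cutSize G' (preimage A) ≤ cutSize G A
  cutSize-preimage-≤ A = ∣p∣≤∣q∣-by-injection ψ ψ-inj _ _ λ {e} e∈ →
    x∈tabulate⁺ (crosses G A) (trans (crosses-ψ A e) (x∈tabulate⁻ (crosses G' (preimage A)) e∈))

  ∣preimage∣≤ : ∀ C → ∣ preimage C ∣ ≤ ∣ C ∣
  ∣preimage∣≤ C = ∣p∣≤∣q∣-by-injection φ φ-inj (preimage C) C ∈-preimage⁻

  HittingSet-preimage : ∀ S' C → HittingSet G (map image S') C → HittingSet G' S' (preimage C)
  HittingSet-preimage S' C hits F F∈S' with hits (image F) (∈-map⁺ image F∈S')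
  ... | v , v∈C , v∈φ[F] with ∈-image⁻ v∈φ[F]
  ...   | u , u∈F , refl = u , ∈-preimage⁺ v∈C , u∈F

  OrderCondition-image : ∀ S' k → OrderCondition G' S' k → OrderCondition G (map image S') k
  OrderCondition-image S' k (unhittable , cut-bound) = unhittable-image , cut-bound-image
    where
    unhittable-image : ∀ C → ∣ C ∣ < k → HittingSet G (map image S') C → Empty.⊥
    unhittable-image C ∣C∣<k hits =
      unhittable (preimage C) (≤-<-trans (∣preimage∣≤ C) ∣C∣<k) (HittingSet-preimage S' C hits)
    cut-bound-image : ∀ A E E' → E ∈ₗ map image S' → E' ∈ₗ map image S' → E ⊆ A → E' ⊆ ∁ A →
      k ≤ cutSize G A
    cut-bound-image A E E' E∈ E'∈ E⊆A E'⊆∁A with ∈-map⁻ image E∈ | ∈-map⁻ image E'∈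
    ... | F , F∈S' , refl | F' , F'∈S' , refl =
      ≤-trans (cut-bound (preimage A) F F' F∈S' F'∈S' F⊆φ⁻¹[A] F'⊆∁φ⁻¹[A]) (cutSize-preimage-≤ A)
      where
      F⊆φ⁻¹[A] : F ⊆ preimage A
      F⊆φ⁻¹[A] u∈F = ∈-preimage⁺ (E⊆A (∈-image⁺ u∈F))
      F'⊆∁φ⁻¹[A] : F' ⊆ ∁ (preimage A)
      F'⊆∁φ⁻¹[A] u∈F' = x∉p⇒x∈∁p λ u∈φ⁻¹[A] →
        x∈∁p⇒x∉p (E'⊆∁A (∈-image⁺ u∈F')) (∈-preimage⁻ u∈φ⁻¹[A])

  image-scramble : Scramble G' → Scramble G
  image-scramble (S' , S'-connected) = map image S' , connected
    where
    connected : ∀ E → E ∈ₗ map image S' → ConnectedSet G E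
    connected E E∈ with ∈-map⁻ image E∈
    ... | F , F∈S' , refl = ConnectedSet-image F (S'-connected F F∈S')

proposition4p5 : (G G' : Graph) → ConnectedGraph G → IsSubgraph G' G → ConnectedGraph G'
    → (s s' : ℕ) → IsScrambleNumber G s → IsScrambleNumber G' s' → s' ≤ s
proposition4p5 G G' _ G'⊆G _ s s' (_ , sn-greatest) (((S' , S'-connected) , ‖S'‖-ok , _) , _) =
  decidable-stable (s' ≤? s) λ s'≰s →
    ¬¬-greatest (OrderCondition G (map image S')) (OrderCondition⇒≤nV G (map image S'))
      (OrderCondition-image S' s' ‖S'‖-ok)
      λ (k , k-ok , k-greatest , s'≤k) →
        s'≰s (≤-trans s'≤k (sn-greatest (image-scramble (S' , S'-connected)) k (k-ok , k-greatest)))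
  where open Pushforward G G' G'⊆G
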